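{- Let $X\subseteq[u]$ with $|X|=n$. The number of $2t$-tuples $(x_1,\dots,x_{2t})\in X^{2t}$ such that $x_1\oplus\cdots\oplus x_{2t}=\emptyset$ is at most $((2t-1)!!)^c n^t$, where $(2t-1)!!=(2t-1)(2t-3)\cdots3\cdot1$.
   Context: Keys $x\in[u]$ are vectors $(x_0,\dots,x_{c-1})$ of $c$ characters from an alphabet $\Sigma$. A position character is an element of $[c]\times\Sigma$, and a key $x$ is identified with the set of its $c$ position characters $\{(0,x_0),\dots,(c-1,x_{c-1})\}$. For keys $x_1,\dots,x_m$, $x_1\oplus\cdots\oplus x_m$ denotes the symmetric difference of their sets of position characters; thus $x_1\oplus\cdots\oplus x_{2t}=\emptyset$ means every position character occurs an even number of times among $x_1,\dots,x_{2t}$ (counted with multiplicity over the tuple). -}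

module Defs where

open import Data.Nat using (ℕ; zero; suc; _+_; _*_)
open import Data.Bool using (Bool; true; false; _xor_)
open import Data.Fin using (Fin; _≟_)
open import Data.Fin.Properties using (all?)
open import Data.Vec using (Vec; lookup)
open import Data.List using (List; []; _∷_; map; concatMap; foldr)
open import Relation.Nullary using (Dec; does)
open import Relation.Binary.PropositionalEquality using (_≡_)
open import Data.Bool.Properties renaming (_≟_ to _≟ᵇ_)

Key : ℕ → ℕ → Set
Key c s = Vec (Fin s) c

-- A set of position characters, i.e. a subset of [c] × Σ, as a characteristic function.
PosCharSet : ℕ → ℕ → Set
PosCharSet c s = Fin c → Fin s → Bool

-- The key x identified with its set of position characters {(i, x_i)}.
posChars : ∀ {c s} → Key c s → PosCharSet c s
posChars x i a = does (lookup x i ≟ a)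

emptySet : ∀ {c s} → PosCharSet c s
emptySet _ _ = false

_⊕_ : ∀ {c s} → PosCharSet c s → PosCharSet c s → PosCharSet c s
(A ⊕ B) i a = A i a xor B i a

⊕-all : ∀ {c s} → List (Key c s) → PosCharSet c s
⊕-all = foldr (λ x acc → posChars x ⊕ acc) emptySet

IsEmpty : ∀ {c s} → PosCharSet c s → Set
IsEmpty S = ∀ i a → S i a ≡ false

isEmpty? : ∀ {c s} (S : PosCharSet c s) → Dec (IsEmpty S)
isEmpty? S = all? (λ i → all? (λ a → S i a ≟ᵇ false))

tuples : ∀ {A : Set} → List A → ℕ → List (List A)
tuples X zero = [] ∷ []
tuples X (suc m) = concatMap (λ x → map (x ∷_) (tuples X m)) X

-- Double factorial of odd numbers: oddDoubleFact t = (2t-1)!! = (2t-1)(2t-3)⋯3·1.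
oddDoubleFact : ℕ → ℕ
oddDoubleFact zero = 1
oddDoubleFact (suc t) = suc (2 * t) * oddDoubleFact t

module Submission where

-- Generalise X^{2t} to a product L₁ × ⋯ × Lₘ of duplicate-free lists of keys and show, by induction on
-- the number c of characters, that the number N of tuples in which every column has each character an even
-- number of times satisfies N² ≤ ((m − 1)!!)^{2c} · ∏ |Lᵢ|.  With c = 0 each Lᵢ has at most one element.
-- For c + 1, group the tuples by their vector a ∈ Σᵐ of first characters, which must itself be even; by
-- induction the square of each group is at most C · ∏ wᵢ(aᵢ) with C = ((m − 1)!!)^{2c}, where wᵢ(b)
-- counts the keys of Lᵢ starting with b.  In an even vector (b, r) some entry rⱼ equals b; summing over j,
-- deleting that pair and applying Cauchy–Schwarz over b passes from m to m − 2 at the price of a factor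
-- (m − 1)², so the squared total is at most C · ((m − 1)!!)² · ∏ Σ_b wᵢ(b) = C · ((m − 1)!!)² · ∏ |Lᵢ|.
-- Keeping squares avoids square roots.

open import Defs
open import Data.Nat using (ℕ; _*_; _^_; _≤_)
open import Data.List using (List; length; filter)
open import Data.List.Relation.Unary.Unique.Propositional using (Unique)
open import Relation.Binary.PropositionalEquality using (_≡_)

open import Data.Bool using (Bool; true; false; if_then_else_; not; _xor_)
open import Data.Bool.Properties using (not-involutive; true-xor; xor-same; xor-assoc) renaming (_≟_ to _≟ᵇ_)
open import Data.Empty using (⊥-elim)
open import Data.Fin using (Fin; zero; suc; _≟_)
open import Data.Fin.Properties using (all?)
open import Data.List using ([]; _∷_; _++_; map; concatMap)
open import Data.List.Relation.Unary.All using (All; []; _∷_)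
open import Data.List.Relation.Unary.AllPairs using ([]; _∷_)
open import Data.Nat using (zero; suc; _+_; z≤n; s≤s)
open import Data.Nat.Properties
  using (+-*-semiring; *-commutativeSemigroup; ≤-refl; ≤-trans; ≤-reflexive; ≤-total; ≮⇒≥; <⇒≱;
         +-mono-≤; *-mono-≤; *-mono-<; *-monoʳ-≤; m≤m+n; m≤n+m; m≤n⇒∃[o]m+o≡n;
         +-comm; +-assoc; +-identityʳ; *-comm; *-suc; *-zeroʳ; *-identityʳ; *-distribˡ-+; ^-distribˡ-+-*;
         module ≤-Reasoning)
open import Data.Nat.Tactic.RingSolver using (solve-∀)
open import Data.Product using (∃-syntax; _×_; _,_)
open import Data.Sum using (inj₁; inj₂)
open import Data.Vec using (Vec; []; _∷_; head; tail; lookup; insertAt; removeAt; zipWith; replicate; toList)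
  renaming (map to mapⱽ)
open import Data.Vec.Properties using (map-cong; map-∘; lookup-zipWith; lookup-replicate)
open import Function using (_∘_)
open import Relation.Binary.PropositionalEquality
  using (_≢_; refl; sym; trans; cong; cong₂; subst; subst₂; module ≡-Reasoning)
open import Relation.Nullary using (Dec; yes; no; does; ¬_)
open import Relation.Nullary.Decidable using (dec-true; dec-false; _×-dec_)

open import Algebra.Properties.CommutativeSemigroup *-commutativeSemigroup using (x∙yz≈y∙xz)
open import Algebra.Properties.Semiring.Sum +-*-semiring
  using (sum; sum-syntax; sum-cong-≗; ∑-distrib-+; ∑-comm; *-distribˡ-sum; *-distribʳ-sum; sum-replicate-zero)

-- Squares and the Cauchy–Schwarz inequality in ℕ

infixl 9 _²

_² : ℕ → ℕ
n ² = n * n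

²-mono-≤ : ∀ {m n} → m ≤ n → m ² ≤ n ²
²-mono-≤ m≤n = *-mono-≤ m≤n m≤n

²-cancel-≤ : ∀ {m n} → m ² ≤ n ² → m ≤ n
²-cancel-≤ m²≤n² = ≮⇒≥ (λ n<m → <⇒≱ (*-mono-< n<m n<m) m²≤n²)

n≤1⇒n²≤n : ∀ {n} → n ≤ 1 → n ² ≤ n
n≤1⇒n²≤n z≤n       = z≤n
n≤1⇒n²≤n (s≤s z≤n) = ≤-refl

4mn≤[m+n]²-ordered : ∀ {m n} → m ≤ n → 4 * (m * n) ≤ (m + n) ²
4mn≤[m+n]²-ordered {m} m≤n with d , refl ← m≤n⇒∃[o]m+o≡n m≤n =
  subst (4 * (m * (m + d)) ≤_) (gap m d) (m≤m+n _ (d * d))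
  where
  gap : ∀ m d → 4 * (m * (m + d)) + d * d ≡ (m + (m + d)) * (m + (m + d))
  gap = solve-∀

4mn≤[m+n]² : ∀ m n → 4 * (m * n) ≤ (m + n) ²
4mn≤[m+n]² m n with ≤-total m n
... | inj₁ m≤n = 4mn≤[m+n]²-ordered m≤n
... | inj₂ n≤m = subst₂ _≤_ (cong (4 *_) (*-comm n m)) (cong _² (+-comm n m)) (4mn≤[m+n]²-ordered n≤m)

cauchy-schwarz₂ : ∀ {h k u U v V} → h ² ≤ u * v → k ² ≤ U * V → (h + k) ² ≤ (u + U) * (v + V)
cauchy-schwarz₂ {h} {k} {u} {U} {v} {V} h²≤uv k²≤UV = begin
  (h + k) ²                       ≡⟨ expand h k ⟩
  h ² + 2 * (h * k) + k ²         ≤⟨ +-mono-≤ (+-mono-≤ h²≤uv cross) k²≤UV ⟩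
  u * v + (u * V + U * v) + U * V ≡⟨ collect u U v V ⟩
  (u + U) * (v + V)               ∎
  where
  open ≤-Reasoning
  expand : ∀ h k → (h + k) * (h + k) ≡ h * h + 2 * (h * k) + k * k
  expand = solve-∀
  collect : ∀ u U v V → u * v + (u * V + U * v) + U * V ≡ (u + U) * (v + V)
  collect = solve-∀
  cross : 2 * (h * k) ≤ u * V + U * v
  cross = ²-cancel-≤ (begin
    (2 * (h * k)) ²           ≡⟨ square-double h k ⟩
    4 * (h ² * k ²)           ≤⟨ *-monoʳ-≤ 4 (*-mono-≤ h²≤uv k²≤UV) ⟩
    4 * ((u * v) * (U * V))   ≡⟨ swap-factors u U v V ⟩
    4 * ((u * V) * (U * v))   ≤⟨ 4mn≤[m+n]² (u * V) (U * v) ⟩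
    (u * V + U * v) ²         ∎)
    where
    square-double : ∀ h k → (2 * (h * k)) * (2 * (h * k)) ≡ 4 * ((h * h) * (k * k))
    square-double = solve-∀
    swap-factors : ∀ u U v V → 4 * ((u * v) * (U * V)) ≡ 4 * ((u * V) * (U * v))
    swap-factors = solve-∀

indicator : ∀ {P : Set} → Dec P → ℕ
indicator p = if does p then 1 else 0

indicator-true : ∀ {P : Set} (p : Dec P) → P → indicator p ≡ 1
indicator-true p x = cong (if_then 1 else 0) (dec-true p x)

indicator-false : ∀ {P : Set} (p : Dec P) → ¬ P → indicator p ≡ 0
indicator-false p ¬x = cong (if_then 1 else 0) (dec-false p ¬x)

indicator-*-≤ : ∀ {P : Set} (p : Dec P) n → indicator p * n ≤ n
indicator-*-≤ (yes _) n = ≤-reflexive (+-identityʳ n)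
indicator-*-≤ (no _)  n = z≤n

indicator-⇔ : ∀ {P Q : Set} (p : Dec P) (q : Dec Q) → (P → Q) → (Q → P) → indicator p ≡ indicator q
indicator-⇔ (yes _) (yes _) _   _   = refl
indicator-⇔ (yes x) (no ¬y) P→Q _   = ⊥-elim (¬y (P→Q x))
indicator-⇔ (no ¬x) (yes y) _   Q→P = ⊥-elim (¬x (Q→P y))
indicator-⇔ (no _)  (no _)  _   _   = refl

indicator-×-dec : ∀ {P Q : Set} (p : Dec P) (q : Dec Q) → indicator (p ×-dec q) ≡ indicator p * indicator q
indicator-×-dec (yes _) (yes _) = refl
indicator-×-dec (yes _) (no _)  = refl
indicator-×-dec (no _)  _       = refl

sum-mono-≤ : ∀ {n} {f g : Fin n → ℕ} → (∀ i → f i ≤ g i) → sum f ≤ sum g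
sum-mono-≤ {zero}  f≤g = z≤n
sum-mono-≤ {suc n} f≤g = +-mono-≤ (f≤g zero) (sum-mono-≤ (f≤g ∘ suc))

sum-const : ∀ n x → ∑[ i < n ] x ≡ n * x
sum-const zero    x = refl
sum-const (suc n) x = cong (x +_) (sum-const n x)

≤-sum : ∀ {n} (f : Fin n → ℕ) i → f i ≤ sum f
≤-sum f zero    = m≤m+n _ _
≤-sum f (suc i) = ≤-trans (≤-sum (f ∘ suc) i) (m≤n+m _ _)

sum-indicator-≟ : ∀ {n} (b : Fin n) (g : Fin n → ℕ) → ∑[ a < n ] (indicator (a ≟ b) * g a) ≡ g b
sum-indicator-≟ {suc n} zero g = begin
  g zero + 0 + ∑[ a < n ] 0 ≡⟨ cong (g zero + 0 +_) (sum-replicate-zero n) ⟩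
  g zero + 0 + 0            ≡⟨ +-identityʳ _ ⟩
  g zero + 0                ≡⟨ +-identityʳ _ ⟩
  g zero                    ∎
  where open ≡-Reasoning
sum-indicator-≟ {suc n} (suc b) g = sum-indicator-≟ b (g ∘ suc)

sum-cauchy-schwarz : ∀ {n} {h u v : Fin n → ℕ} → (∀ i → h i ² ≤ u i * v i) → sum h ² ≤ sum u * sum v
sum-cauchy-schwarz {zero}  hyp = z≤n
sum-cauchy-schwarz {suc n} {h} {u} {v} hyp =
  cauchy-schwarz₂ {h zero} {sum (h ∘ suc)} {u zero} {sum (u ∘ suc)} {v zero} {sum (v ∘ suc)}
    (hyp zero) (sum-cauchy-schwarz (hyp ∘ suc))

sum-²-≤ : ∀ {n} {h : Fin n → ℕ} {B} → (∀ i → h i ² ≤ B) → sum h ² ≤ n ² * B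
sum-²-≤ {n} {h} {B} hyp = begin
  sum h ²                                  ≤⟨ sum-cauchy-schwarz {u = λ _ → 1} {v = λ _ → B} hyp′ ⟩
  ∑[ i < n ] 1 * ∑[ i < n ] B               ≡⟨ cong₂ _*_ (sum-const n 1) (sum-const n B) ⟩
  n * 1 * (n * B)                          ≡⟨ regroup n B ⟩
  n ² * B                                  ∎
  where
  open ≤-Reasoning
  hyp′ : ∀ i → h i ² ≤ 1 * B
  hyp′ i = subst (h i ² ≤_) (sym (+-identityʳ B)) (hyp i)
  regroup : ∀ n B → n * 1 * (n * B) ≡ n * n * B
  regroup = solve-∀

sumVec : ∀ {s} m → (Vec (Fin s) m → ℕ) → ℕ
sumVec         zero    f = f []
sumVec {s = s} (suc m) f = ∑[ a < s ] sumVec m (λ v → f (a ∷ v))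

sumVec-cong : ∀ {s} m {f g : Vec (Fin s) m → ℕ} → (∀ v → f v ≡ g v) → sumVec m f ≡ sumVec m g
sumVec-cong zero    f≡g = f≡g []
sumVec-cong (suc m) f≡g = sum-cong-≗ (λ a → sumVec-cong m (λ v → f≡g (a ∷ v)))

sumVec-mono-≤ : ∀ {s} m {f g : Vec (Fin s) m → ℕ} → (∀ v → f v ≤ g v) → sumVec m f ≤ sumVec m g
sumVec-mono-≤ zero    f≤g = f≤g []
sumVec-mono-≤ (suc m) f≤g = sum-mono-≤ (λ a → sumVec-mono-≤ m (λ v → f≤g (a ∷ v)))

*-distribˡ-sumVec : ∀ {s} m d (f : Vec (Fin s) m → ℕ) → sumVec m (λ v → d * f v) ≡ d * sumVec m f
*-distribˡ-sumVec zero    d f = refl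
*-distribˡ-sumVec (suc m) d f = trans (sum-cong-≗ (λ a → *-distribˡ-sumVec m d (λ v → f (a ∷ v))))
                                      (sym (*-distribˡ-sum d (λ a → sumVec m (λ v → f (a ∷ v)))))

sumVec-comm-sum : ∀ {s n} m (f : Vec (Fin s) m → Fin n → ℕ) →
  sumVec m (λ v → ∑[ j < n ] f v j) ≡ ∑[ j < n ] sumVec m (λ v → f v j)
sumVec-comm-sum zero    f = refl
sumVec-comm-sum (suc m) f = trans (sum-cong-≗ (λ a → sumVec-comm-sum m (λ v → f (a ∷ v))))
                                  (∑-comm (λ a j → sumVec m (λ v → f (a ∷ v) j)))

sumVec-insertAt : ∀ {s} k (j : Fin (suc k)) (b : Fin s) (F : Vec (Fin s) (suc k) → ℕ) →
  sumVec (suc k) (λ v → indicator (lookup v j ≟ b) * F v) ≡ sumVec k (λ r → F (insertAt r j b))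
sumVec-insertAt k zero b F =
  trans (sum-cong-≗ (λ a → *-distribˡ-sumVec k (indicator (a ≟ b)) (λ v → F (a ∷ v))))
        (sum-indicator-≟ b (λ a → sumVec k (λ v → F (a ∷ v))))
sumVec-insertAt (suc k) (suc j) b F = sum-cong-≗ (λ a → sumVec-insertAt k j b (λ v → F (a ∷ v)))

-- Parity of the occurrences of a character

parity : ∀ {s m} → Fin s → Vec (Fin s) m → Bool
parity a []      = false
parity a (b ∷ v) = does (b ≟ a) xor parity a v

AllEven : ∀ {s m} → Vec (Fin s) m → Set
AllEven v = ∀ a → parity a v ≡ false

allEven? : ∀ {s m} (v : Vec (Fin s) m) → Dec (AllEven v)
allEven? v = all? (λ a → parity a v ≟ᵇ false)

xor-swap : ∀ x y z → x xor (y xor z) ≡ y xor (x xor z)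
xor-swap false y     z = refl
xor-swap true  false z = refl
xor-swap true  true  z = refl

parity-insertAt : ∀ {s k} (a b : Fin s) (r : Vec (Fin s) k) j →
  parity a (insertAt r j b) ≡ does (b ≟ a) xor parity a r
parity-insertAt a b r       zero    = refl
parity-insertAt a b (x ∷ r) (suc j) =
  trans (cong (does (x ≟ a) xor_) (parity-insertAt a b r j)) (xor-swap (does (x ≟ a)) (does (b ≟ a)) (parity a r))

AllEven-insertAt⁻ : ∀ {s k} (b : Fin s) (r : Vec (Fin s) k) j → AllEven (b ∷ insertAt r j b) → AllEven r
AllEven-insertAt⁻ b r j even a = begin
  parity a r                                      ≡⟨ cong (_xor parity a r) (xor-same (does (b ≟ a))) ⟨
  (does (b ≟ a) xor does (b ≟ a)) xor parity a r  ≡⟨ xor-assoc (does (b ≟ a)) _ _ ⟩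
  does (b ≟ a) xor (does (b ≟ a) xor parity a r)  ≡⟨ cong (does (b ≟ a) xor_) (parity-insertAt a b r j) ⟨
  parity a (b ∷ insertAt r j b)                   ≡⟨ even a ⟩
  false                                           ∎
  where open ≡-Reasoning

parity-true⇒lookup : ∀ {s m} (b : Fin s) (r : Vec (Fin s) m) → parity b r ≡ true → ∃[ j ] lookup r j ≡ b
parity-true⇒lookup b []      ()
parity-true⇒lookup b (x ∷ r) odd with x ≟ b
... | yes x≡b = zero , x≡b
... | no  _   with j , rⱼ≡b ← parity-true⇒lookup b r odd = suc j , rⱼ≡b

AllEven-∷⇒partner : ∀ {s m} (b : Fin s) (r : Vec (Fin s) m) → AllEven (b ∷ r) → ∃[ j ] lookup r j ≡ b
AllEven-∷⇒partner b r even = parity-true⇒lookup b r (begin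
  parity b r                          ≡⟨ not-involutive (parity b r) ⟨
  not (not (parity b r))              ≡⟨ cong not (true-xor (parity b r)) ⟨
  not (true xor parity b r)           ≡⟨ cong (λ d → not (d xor parity b r)) (dec-true (b ≟ b) refl) ⟨
  not (parity b (b ∷ r))              ≡⟨ cong not (even b) ⟩
  true                                ∎)
  where open ≡-Reasoning

¬AllEven-[_] : ∀ {s} (b : Fin s) → ¬ AllEven (b ∷ [])
¬AllEven-[ b ] even with () , _ ← AllEven-∷⇒partner b [] even

-- predDoubleFact m = (m − 1)!! (with (−1)!! = 1); for even m it counts the perfect matchings of m points.
predDoubleFact : ℕ → ℕ
predDoubleFact 0             = 1
predDoubleFact 1             = 1
predDoubleFact (suc (suc k)) = suc k * predDoubleFact k

prodAt : ∀ {s m} → Vec (Fin s → ℕ) m → Vec (Fin s) m → ℕ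
prodAt []       []      = 1
prodAt (w ∷ ws) (a ∷ v) = w a * prodAt ws v

prodSum : ∀ {s m} → Vec (Fin s → ℕ) m → ℕ
prodSum []       = 1
prodSum (w ∷ ws) = sum w * prodSum ws

prodAt-insertAt : ∀ {s k} (ws : Vec (Fin s → ℕ) (suc k)) j b (r : Vec (Fin s) k) →
  prodAt ws (insertAt r j b) ≡ lookup ws j b * prodAt (removeAt ws j) r
prodAt-insertAt (w ∷ ws)     zero    b r       = refl
prodAt-insertAt (w ∷ ws@(_ ∷ _)) (suc j) b (x ∷ r) =
  trans (cong (w x *_) (prodAt-insertAt ws j b r)) (x∙yz≈y∙xz (w x) (lookup ws j b) (prodAt (removeAt ws j) r))

prodSum-removeAt : ∀ {s k} (ws : Vec (Fin s → ℕ) (suc k)) j → prodSum ws ≡ sum (lookup ws j) * prodSum (removeAt ws j)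
prodSum-removeAt (w ∷ ws)         zero    = refl
prodSum-removeAt (w ∷ ws@(_ ∷ _)) (suc j) =
  trans (cong (sum w *_) (prodSum-removeAt ws j)) (x∙yz≈y∙xz (sum w) (sum (lookup ws j)) (prodSum (removeAt ws j)))

≤-sum-partners : ∀ {s k} (f : Vec (Fin s) (suc (suc k)) → ℕ) → (∀ v → ¬ AllEven v → f v ≡ 0) →
  ∀ b rest → f (b ∷ rest) ≤ ∑[ j < suc k ] (indicator (lookup rest j ≟ b) * f (b ∷ rest))
≤-sum-partners {k = k} f vanish b rest with allEven? (b ∷ rest)
... | no odd = ≤-trans (≤-reflexive (vanish _ odd)) z≤n
... | yes even with j , restⱼ≡b ← AllEven-∷⇒partner b rest even = begin
  f (b ∷ rest)                                         ≡⟨ +-identityʳ _ ⟨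
  1 * f (b ∷ rest)                                     ≡⟨ cong (_* f (b ∷ rest)) (indicator-true (lookup rest j ≟ b) restⱼ≡b) ⟨
  indicator (lookup rest j ≟ b) * f (b ∷ rest)         ≤⟨ ≤-sum (λ j → indicator (lookup rest j ≟ b) * f (b ∷ rest)) j ⟩
  ∑[ j < suc k ] (indicator (lookup rest j ≟ b) * f (b ∷ rest)) ∎
  where open ≤-Reasoning

-- Every even vector b ∷ rest repeats b somewhere in rest, so it arises from some r by inserting b at a position j.
sumVec-AllEven-≤ : ∀ {s k} (f : Vec (Fin s) (suc (suc k)) → ℕ) → (∀ v → ¬ AllEven v → f v ≡ 0) →
  sumVec (suc (suc k)) f ≤ ∑[ j < suc k ] sumVec k (λ r → ∑[ b < s ] f (b ∷ insertAt r j b))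
sumVec-AllEven-≤ {s} {k} f vanish = begin
  ∑[ b < s ] sumVec (suc k) (λ rest → f (b ∷ rest))
    ≤⟨ sum-mono-≤ (λ b → sumVec-mono-≤ (suc k) (≤-sum-partners f vanish b)) ⟩
  ∑[ b < s ] sumVec (suc k) (λ rest → ∑[ j < suc k ] (indicator (lookup rest j ≟ b) * f (b ∷ rest)))
    ≡⟨ sum-cong-≗ (λ b → sumVec-comm-sum (suc k) (λ rest j → indicator (lookup rest j ≟ b) * f (b ∷ rest))) ⟩
  ∑[ b < s ] ∑[ j < suc k ] sumVec (suc k) (λ rest → indicator (lookup rest j ≟ b) * f (b ∷ rest))
    ≡⟨ sum-cong-≗ (λ b → sum-cong-≗ (λ j → sumVec-insertAt k j b (λ rest → f (b ∷ rest)))) ⟩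
  ∑[ b < s ] ∑[ j < suc k ] sumVec k (λ r → f (b ∷ insertAt r j b))
    ≡⟨ ∑-comm (λ b j → sumVec k (λ r → f (b ∷ insertAt r j b))) ⟩
  ∑[ j < suc k ] ∑[ b < s ] sumVec k (λ r → f (b ∷ insertAt r j b))
    ≡⟨ sum-cong-≗ (λ j → sumVec-comm-sum k (λ r b → f (b ∷ insertAt r j b))) ⟨
  ∑[ j < suc k ] sumVec k (λ r → ∑[ b < s ] f (b ∷ insertAt r j b)) ∎
  where open ≤-Reasoning

sum-insertAt-²-≤ : ∀ {s k} C (w : Fin s → ℕ) (ws : Vec (Fin s → ℕ) (suc k)) (f : Vec (Fin s) (suc (suc k)) → ℕ) →
  (∀ v → f v ² ≤ C * prodAt (w ∷ ws) v) →
  ∀ j r → (∑[ b < s ] f (b ∷ insertAt r j b)) ² ≤ C * sum w * sum (lookup ws j) * prodAt (removeAt ws j) r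
sum-insertAt-²-≤ {s} C w ws f bound j r = begin
  (∑[ b < s ] f (b ∷ insertAt r j b)) ²       ≤⟨ sum-cauchy-schwarz {u = w} {v = λ b → C * (wⱼ b * P)} pointwise ⟩
  sum w * ∑[ b < s ] (C * (wⱼ b * P))          ≡⟨ cong (sum w *_) factor ⟩
  sum w * (C * (sum wⱼ * P))                   ≡⟨ regroup (sum w) C (sum wⱼ) P ⟩
  C * sum w * sum wⱼ * P                       ∎
  where
  open ≤-Reasoning
  wⱼ = lookup ws j
  P = prodAt (removeAt ws j) r
  pointwise : ∀ b → f (b ∷ insertAt r j b) ² ≤ w b * (C * (wⱼ b * P))
  pointwise b = ≤-trans (bound (b ∷ insertAt r j b)) (≤-reflexive (begin-equality
    C * (w b * prodAt ws (insertAt r j b)) ≡⟨ cong (λ x → C * (w b * x)) (prodAt-insertAt ws j b r) ⟩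
    C * (w b * (wⱼ b * P))                 ≡⟨ x∙yz≈y∙xz C (w b) (wⱼ b * P) ⟩
    w b * (C * (wⱼ b * P))                 ∎))
  factor : ∑[ b < s ] (C * (wⱼ b * P)) ≡ C * (sum wⱼ * P)
  factor = trans (sym (*-distribˡ-sum C (λ b → wⱼ b * P))) (cong (C *_) (sym (*-distribʳ-sum P wⱼ)))
  regroup : ∀ a c l p → a * (c * (l * p)) ≡ c * a * l * p
  regroup = solve-∀

sumVec-AllEven-²-≤ : ∀ {s} m C (ws : Vec (Fin s → ℕ) m) (f : Vec (Fin s) m → ℕ) →
  (∀ v → ¬ AllEven v → f v ≡ 0) → (∀ v → f v ² ≤ C * prodAt ws v) →
  sumVec m f ² ≤ C * predDoubleFact m ² * prodSum ws
sumVec-AllEven-²-≤ 0 C [] f vanish bound = subst (f [] ² ≤_) (cong (_* 1) (sym (*-identityʳ C))) (bound [])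
sumVec-AllEven-²-≤ {s} 1 C ws f vanish bound
  rewrite sum-cong-≗ (λ a → vanish (a ∷ []) ¬AllEven-[ a ]) | sum-replicate-zero s = z≤n
sumVec-AllEven-²-≤ {s} (suc (suc k)) C (w ∷ ws) f vanish bound = begin
  sumVec (suc (suc k)) f ²                              ≤⟨ ²-mono-≤ (sumVec-AllEven-≤ f vanish) ⟩
  (∑[ j < suc k ] S j) ²                                ≤⟨ sum-²-≤ {h = S} S-bound ⟩
  suc k ² * (C * predDoubleFact k ² * prodSum (w ∷ ws)) ≡⟨ regroup (suc k) C (predDoubleFact k) (prodSum (w ∷ ws)) ⟩
  C * predDoubleFact (suc (suc k)) ² * prodSum (w ∷ ws) ∎
  where
  open ≤-Reasoning
  g : Fin (suc k) → Vec (Fin s) k → ℕ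
  g j r = ∑[ b < s ] f (b ∷ insertAt r j b)
  S : Fin (suc k) → ℕ
  S j = sumVec k (g j)
  regroup : ∀ n c d p → n * n * (c * (d * d) * p) ≡ c * (n * d * (n * d)) * p
  regroup = solve-∀
  S-bound : ∀ j → S j ² ≤ C * predDoubleFact k ² * prodSum (w ∷ ws)
  S-bound j = begin
    S j ²                                                   ≤⟨ sumVec-AllEven-²-≤ k Cⱼ (removeAt ws j) (g j) g-vanish
                                                                 (sum-insertAt-²-≤ C w ws f bound j) ⟩
    Cⱼ * predDoubleFact k ² * prodSum (removeAt ws j)       ≡⟨ regroup′ C (sum w) Wⱼ (predDoubleFact k) (prodSum (removeAt ws j)) ⟩
    C * predDoubleFact k ² * (sum w * (Wⱼ * prodSum (removeAt ws j))) ≡⟨ cong (λ x → C * predDoubleFact k ² * (sum w * x)) (prodSum-removeAt ws j) ⟨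
    C * predDoubleFact k ² * prodSum (w ∷ ws)               ∎
    where
    Wⱼ = sum (lookup ws j)
    Cⱼ = C * sum w * Wⱼ
    g-vanish : ∀ r → ¬ AllEven r → g j r ≡ 0
    g-vanish r odd = trans (sum-cong-≗ (λ b → vanish _ (odd ∘ AllEven-insertAt⁻ b r j))) (sum-replicate-zero s)
    regroup′ : ∀ c a l d p → c * a * l * (d * d) * p ≡ c * (d * d) * (a * (l * p))
    regroup′ = solve-∀

sumList : ∀ {A : Set} → List A → (A → ℕ) → ℕ
sumList []      f = 0
sumList (x ∷ L) f = f x + sumList L f

sumList-cong : ∀ {A : Set} (L : List A) {f g : A → ℕ} → (∀ x → f x ≡ g x) → sumList L f ≡ sumList L g
sumList-cong []      f≡g = refl
sumList-cong (x ∷ L) f≡g = cong₂ _+_ (f≡g x) (sumList-cong L f≡g)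

sumList-const-1 : ∀ {A : Set} (L : List A) → sumList L (λ _ → 1) ≡ length L
sumList-const-1 []      = refl
sumList-const-1 (x ∷ L) = cong suc (sumList-const-1 L)

*-distribˡ-sumList : ∀ {A : Set} (L : List A) d (f : A → ℕ) → sumList L (λ x → d * f x) ≡ d * sumList L f
*-distribˡ-sumList []      d f = sym (*-zeroʳ d)
*-distribˡ-sumList (x ∷ L) d f = trans (cong (d * f x +_) (*-distribˡ-sumList L d f)) (sym (*-distribˡ-+ d (f x) _))

sumList-++ : ∀ {A : Set} (L M : List A) (f : A → ℕ) → sumList (L ++ M) f ≡ sumList L f + sumList M f
sumList-++ []      M f = refl
sumList-++ (x ∷ L) M f = trans (cong (f x +_) (sumList-++ L M f)) (sym (+-assoc (f x) _ _))

sumList-map : ∀ {A B : Set} (h : A → B) (L : List A) (f : B → ℕ) → sumList (map h L) f ≡ sumList L (f ∘ h)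
sumList-map h []      f = refl
sumList-map h (x ∷ L) f = cong (f (h x) +_) (sumList-map h L f)

sumList-concatMap : ∀ {A B : Set} (g : A → List B) (L : List A) (f : B → ℕ) →
  sumList (concatMap g L) f ≡ sumList L (λ x → sumList (g x) f)
sumList-concatMap g []      f = refl
sumList-concatMap g (x ∷ L) f = trans (sumList-++ (g x) (concatMap g L) f) (cong (sumList (g x) f +_) (sumList-concatMap g L f))

sumList-comm-sum : ∀ {A : Set} {n} (L : List A) (f : A → Fin n → ℕ) →
  sumList L (λ x → ∑[ a < n ] f x a) ≡ ∑[ a < n ] sumList L (λ x → f x a)
sumList-comm-sum {n = n} []      f = sym (sum-replicate-zero n)
sumList-comm-sum         (x ∷ L) f =
  trans (cong (sum (f x) +_) (sumList-comm-sum L f)) (sym (∑-distrib-+ (f x) (λ a → sumList L (λ x → f x a))))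

sumList-comm-sumVec : ∀ {A : Set} {s} m (L : List A) (f : A → Vec (Fin s) m → ℕ) →
  sumList L (λ x → sumVec m (f x)) ≡ sumVec m (λ v → sumList L (λ x → f x v))
sumList-comm-sumVec zero    L f = refl
sumList-comm-sumVec (suc m) L f = trans (sumList-comm-sum L (λ x a → sumVec m (λ v → f x (a ∷ v))))
                                        (sum-cong-≗ (λ a → sumList-comm-sumVec m L (λ x v → f x (a ∷ v))))

sumTuples : ∀ {A : Set} {m} → Vec (List A) m → (Vec A m → ℕ) → ℕ
sumTuples []       f = f []
sumTuples (L ∷ Ls) f = sumList L (λ x → sumTuples Ls (λ xs → f (x ∷ xs)))

prodLength : ∀ {A : Set} {m} → Vec (List A) m → ℕ
prodLength []       = 1
prodLength (L ∷ Ls) = length L * prodLength Ls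

sumTuples-cong : ∀ {A : Set} {m} (Ls : Vec (List A) m) {f g : Vec A m → ℕ} → (∀ xs → f xs ≡ g xs) →
  sumTuples Ls f ≡ sumTuples Ls g
sumTuples-cong []       f≡g = f≡g []
sumTuples-cong (L ∷ Ls) f≡g = sumList-cong L (λ x → sumTuples-cong Ls (λ xs → f≡g (x ∷ xs)))

*-distribˡ-sumTuples : ∀ {A : Set} {m} (Ls : Vec (List A) m) d (f : Vec A m → ℕ) →
  sumTuples Ls (λ xs → d * f xs) ≡ d * sumTuples Ls f
*-distribˡ-sumTuples []       d f = refl
*-distribˡ-sumTuples (L ∷ Ls) d f =
  trans (sumList-cong L (λ x → *-distribˡ-sumTuples Ls d (λ xs → f (x ∷ xs)))) (*-distribˡ-sumList L d _)

sumTuples-const-1 : ∀ {A : Set} {m} (Ls : Vec (List A) m) → sumTuples Ls (λ _ → 1) ≡ prodLength Ls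
sumTuples-const-1 []       = refl
sumTuples-const-1 (L ∷ Ls) = begin
  sumList L (λ _ → sumTuples Ls (λ _ → 1)) ≡⟨ sumList-cong L (λ _ → trans (sumTuples-const-1 Ls) (sym (*-identityʳ _))) ⟩
  sumList L (λ _ → prodLength Ls * 1)      ≡⟨ *-distribˡ-sumList L (prodLength Ls) (λ _ → 1) ⟩
  prodLength Ls * sumList L (λ _ → 1)      ≡⟨ cong (prodLength Ls *_) (sumList-const-1 L) ⟩
  prodLength Ls * length L                 ≡⟨ *-comm (prodLength Ls) (length L) ⟩
  length L * prodLength Ls                 ∎
  where open ≡-Reasoning

-- Splitting keys by their first character

tailsWithHead : ∀ {c s} → Fin s → List (Key (suc c) s) → List (Key c s)
tailsWithHead a []            = []
tailsWithHead a ((b ∷ y) ∷ L) with a ≟ b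
... | yes _ = y ∷ tailsWithHead a L
... | no  _ = tailsWithHead a L

sumList-tailsWithHead-∷ : ∀ {c s} (a b : Fin s) (y : Key c s) L (H : Key c s → ℕ) →
  sumList (tailsWithHead a ((b ∷ y) ∷ L)) H ≡ indicator (a ≟ b) * H y + sumList (tailsWithHead a L) H
sumList-tailsWithHead-∷ a b y L H with a ≟ b
... | yes _ = cong (_+ sumList (tailsWithHead a L) H) (sym (+-identityʳ (H y)))
... | no  _ = refl

sumList-by-head : ∀ {c s} (L : List (Key (suc c) s)) (H : Fin s → Key c s → ℕ) →
  sumList L (λ x → H (head x) (tail x)) ≡ ∑[ a < s ] sumList (tailsWithHead a L) (H a)
sumList-by-head {s = s} []            H = sym (sum-replicate-zero s)
sumList-by-head {s = s} ((b ∷ y) ∷ L) H = sym (begin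
  ∑[ a < s ] sumList (tailsWithHead a ((b ∷ y) ∷ L)) (H a)
    ≡⟨ sum-cong-≗ (λ a → sumList-tailsWithHead-∷ a b y L (H a)) ⟩
  ∑[ a < s ] (indicator (a ≟ b) * H a y + sumList (tailsWithHead a L) (H a))
    ≡⟨ ∑-distrib-+ (λ a → indicator (a ≟ b) * H a y) (λ a → sumList (tailsWithHead a L) (H a)) ⟩
  ∑[ a < s ] (indicator (a ≟ b) * H a y) + ∑[ a < s ] sumList (tailsWithHead a L) (H a)
    ≡⟨ cong₂ _+_ (sum-indicator-≟ b (λ a → H a y)) (sym (sumList-by-head L H)) ⟩
  H b y + sumList L (λ x → H (head x) (tail x)) ∎)
  where open ≡-Reasoning

sumTuples-by-heads : ∀ {c s m} (Ls : Vec (List (Key (suc c) s)) m) (F : Vec (Fin s) m → Vec (Key c s) m → ℕ) →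
  sumTuples Ls (λ xs → F (mapⱽ head xs) (mapⱽ tail xs)) ≡ sumVec m (λ as → sumTuples (zipWith tailsWithHead as Ls) (F as))
sumTuples-by-heads []                 F = refl
sumTuples-by-heads {m = suc m} (L ∷ Ls) F = begin
  sumList L (λ x → sumTuples Ls (λ xs → F (head x ∷ mapⱽ head xs) (tail x ∷ mapⱽ tail xs)))
    ≡⟨ sumList-cong L (λ x → sumTuples-by-heads Ls (λ as ys → F (head x ∷ as) (tail x ∷ ys))) ⟩
  sumList L (λ x → G (head x) (tail x))
    ≡⟨ sumList-by-head L G ⟩
  ∑[ a < _ ] sumList (tailsWithHead a L) (G a)
    ≡⟨ sum-cong-≗ (λ a → sumList-comm-sumVec m (tailsWithHead a L) (λ y as → sumTuples (zipWith tailsWithHead as Ls) (λ ys → F (a ∷ as) (y ∷ ys)))) ⟩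
  sumVec (suc m) (λ as → sumTuples (zipWith tailsWithHead as (L ∷ Ls)) (F as)) ∎
  where
  open ≡-Reasoning
  G : _ → _ → ℕ
  G a y = sumVec m (λ as → sumTuples (zipWith tailsWithHead as Ls) (λ ys → F (a ∷ as) (y ∷ ys)))

sum-length-tailsWithHead : ∀ {c s} (L : List (Key (suc c) s)) → ∑[ a < s ] length (tailsWithHead a L) ≡ length L
sum-length-tailsWithHead {s = s} L = begin
  ∑[ a < s ] length (tailsWithHead a L)              ≡⟨ sum-cong-≗ (λ a → sumList-const-1 (tailsWithHead a L)) ⟨
  ∑[ a < s ] sumList (tailsWithHead a L) (λ _ → 1)   ≡⟨ sumList-by-head L (λ _ _ → 1) ⟨
  sumList L (λ _ → 1)                                ≡⟨ sumList-const-1 L ⟩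
  length L                                           ∎
  where open ≡-Reasoning

tailsWithHead-∌ : ∀ {c s} (a : Fin s) (y : Key c s) (L : List (Key (suc c) s)) →
  All ((a ∷ y) ≢_) L → All (y ≢_) (tailsWithHead a L)
tailsWithHead-∌ a y []            []         = []
tailsWithHead-∌ a y ((b ∷ z) ∷ L) (a∷y≢b∷z ∷ ps) with a ≟ b
... | yes refl = (λ y≡z → a∷y≢b∷z (cong (a ∷_) y≡z)) ∷ tailsWithHead-∌ a y L ps
... | no  _    = tailsWithHead-∌ a y L ps

Unique-tailsWithHead : ∀ {c s} (a : Fin s) (L : List (Key (suc c) s)) → Unique L → Unique (tailsWithHead a L)
Unique-tailsWithHead a []            []       = []
Unique-tailsWithHead a ((b ∷ y) ∷ L) (b∷y∉L ∷ u) with a ≟ b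
... | yes refl = tailsWithHead-∌ a y L b∷y∉L ∷ Unique-tailsWithHead a L u
... | no  _    = Unique-tailsWithHead a L u

-- Tuples of keys with even columns

column : ∀ {c s m} → Fin c → Vec (Key c s) m → Vec (Fin s) m
column i = mapⱽ (λ x → lookup x i)

ColumnsEven : ∀ {c s m} → Vec (Key c s) m → Set
ColumnsEven xs = ∀ i → AllEven (column i xs)

columnsEven? : ∀ {c s m} (xs : Vec (Key c s) m) → Dec (ColumnsEven xs)
columnsEven? xs = all? (λ i → allEven? (column i xs))

column-zero : ∀ {c s m} (xs : Vec (Key (suc c) s) m) → column zero xs ≡ mapⱽ head xs
column-zero = map-cong (λ { (a ∷ y) → refl })

column-suc : ∀ {c s m} (i : Fin c) (xs : Vec (Key (suc c) s) m) → column (suc i) xs ≡ column i (mapⱽ tail xs)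
column-suc i xs = trans (map-cong (λ { (a ∷ y) → refl }) xs) (map-∘ (λ y → lookup y i) tail xs)

ColumnsEven-split : ∀ {c s m} (xs : Vec (Key (suc c) s) m) →
  ColumnsEven xs → AllEven (mapⱽ head xs) × ColumnsEven (mapⱽ tail xs)
ColumnsEven-split xs even = subst AllEven (column-zero xs) (even zero) , λ i → subst AllEven (column-suc i xs) (even (suc i))

ColumnsEven-join : ∀ {c s m} (xs : Vec (Key (suc c) s) m) →
  AllEven (mapⱽ head xs) → ColumnsEven (mapⱽ tail xs) → ColumnsEven xs
ColumnsEven-join xs evenHeads evenTails zero    = subst AllEven (sym (column-zero xs)) evenHeads
ColumnsEven-join xs evenHeads evenTails (suc i) = subst AllEven (sym (column-suc i xs)) (evenTails i)

countEven : ∀ {c s m} → Vec (List (Key c s)) m → ℕ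
countEven Ls = sumTuples Ls (λ xs → indicator (columnsEven? xs))

countEven-by-heads : ∀ {c s m} (Ls : Vec (List (Key (suc c) s)) m) →
  countEven Ls ≡ sumVec m (λ as → indicator (allEven? as) * countEven (zipWith tailsWithHead as Ls))
countEven-by-heads {m = m} Ls = begin
  sumTuples Ls (λ xs → indicator (columnsEven? xs))
    ≡⟨ sumTuples-cong Ls (λ xs → split xs) ⟩
  sumTuples Ls (λ xs → indicator (allEven? (mapⱽ head xs)) * indicator (columnsEven? (mapⱽ tail xs)))
    ≡⟨ sumTuples-by-heads Ls (λ as ys → indicator (allEven? as) * indicator (columnsEven? ys)) ⟩
  sumVec m (λ as → sumTuples (zipWith tailsWithHead as Ls) (λ ys → indicator (allEven? as) * indicator (columnsEven? ys)))
    ≡⟨ sumVec-cong m (λ as → *-distribˡ-sumTuples (zipWith tailsWithHead as Ls) (indicator (allEven? as)) _) ⟩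
  sumVec m (λ as → indicator (allEven? as) * countEven (zipWith tailsWithHead as Ls)) ∎
  where
  open ≡-Reasoning
  split : ∀ xs → indicator (columnsEven? xs) ≡ indicator (allEven? (mapⱽ head xs)) * indicator (columnsEven? (mapⱽ tail xs))
  split xs = trans (indicator-⇔ (columnsEven? xs) (allEven? (mapⱽ head xs) ×-dec columnsEven? (mapⱽ tail xs))
                                (ColumnsEven-split xs) (λ (h , t) → ColumnsEven-join xs h t))
                   (indicator-×-dec (allEven? (mapⱽ head xs)) (columnsEven? (mapⱽ tail xs)))

countEven-zero : ∀ {s m} (Ls : Vec (List (Key 0 s)) m) → countEven Ls ≡ prodLength Ls
countEven-zero Ls = trans (sumTuples-cong Ls (λ xs → indicator-true (columnsEven? xs) (λ ()))) (sumTuples-const-1 Ls)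

length-Unique-Key0 : ∀ {s} (L : List (Key 0 s)) → Unique L → length L ≤ 1
length-Unique-Key0 []                _                 = z≤n
length-Unique-Key0 (_ ∷ [])          _                 = ≤-refl
length-Unique-Key0 ([] ∷ [] ∷ _)     ((x≢y ∷ _) ∷ _)   = ⊥-elim (x≢y refl)

prodLength-Unique-Key0 : ∀ {s m} (Ls : Vec (List (Key 0 s)) m) → (∀ i → Unique (lookup Ls i)) → prodLength Ls ≤ 1
prodLength-Unique-Key0 []       unique = ≤-refl
prodLength-Unique-Key0 (L ∷ Ls) unique = *-mono-≤ (length-Unique-Key0 L (unique zero)) (prodLength-Unique-Key0 Ls (unique ∘ suc))

headCounts : ∀ {c s m} → Vec (List (Key (suc c) s)) m → Vec (Fin s → ℕ) m
headCounts = mapⱽ (λ L a → length (tailsWithHead a L))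

prodLength-zipWith : ∀ {c s m} (as : Vec (Fin s) m) (Ls : Vec (List (Key (suc c) s)) m) →
  prodLength (zipWith tailsWithHead as Ls) ≡ prodAt (headCounts Ls) as
prodLength-zipWith []       []       = refl
prodLength-zipWith (a ∷ as) (L ∷ Ls) = cong (length (tailsWithHead a L) *_) (prodLength-zipWith as Ls)

prodSum-headCounts : ∀ {c s m} (Ls : Vec (List (Key (suc c) s)) m) → prodSum (headCounts Ls) ≡ prodLength Ls
prodSum-headCounts []       = refl
prodSum-headCounts (L ∷ Ls) = cong₂ _*_ (sum-length-tailsWithHead L) (prodSum-headCounts Ls)

countEven-²-≤ : ∀ c {s m} (Ls : Vec (List (Key c s)) m) → (∀ i → Unique (lookup Ls i)) →
  countEven Ls ² ≤ (predDoubleFact m ^ c) ² * prodLength Ls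
countEven-²-≤ zero Ls unique = begin
  countEven Ls ²      ≡⟨ cong _² (countEven-zero Ls) ⟩
  prodLength Ls ²     ≤⟨ n≤1⇒n²≤n (prodLength-Unique-Key0 Ls unique) ⟩
  prodLength Ls       ≡⟨ +-identityʳ (prodLength Ls) ⟨
  1 * prodLength Ls   ∎
  where open ≤-Reasoning
countEven-²-≤ (suc c) {s} {m} Ls unique = begin
  countEven Ls ²                     ≡⟨ cong _² (countEven-by-heads Ls) ⟩
  sumVec m f ²                       ≤⟨ sumVec-AllEven-²-≤ m C (headCounts Ls) f vanish bound ⟩
  C * D ² * prodSum (headCounts Ls)  ≡⟨ cong₂ _*_ (regroup D (D ^ c)) (prodSum-headCounts Ls) ⟩
  (D ^ suc c) ² * prodLength Ls      ∎
  where
  open ≤-Reasoning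
  D = predDoubleFact m
  C = (D ^ c) ²
  f : Vec (Fin s) m → ℕ
  f as = indicator (allEven? as) * countEven (zipWith tailsWithHead as Ls)
  vanish : ∀ as → ¬ AllEven as → f as ≡ 0
  vanish as odd = cong (_* countEven (zipWith tailsWithHead as Ls)) (indicator-false (allEven? as) odd)
  unique-tails : ∀ as i → Unique (lookup (zipWith tailsWithHead as Ls) i)
  unique-tails as i = subst Unique (sym (lookup-zipWith tailsWithHead i as Ls)) (Unique-tailsWithHead (lookup as i) (lookup Ls i) (unique i))
  bound : ∀ as → f as ² ≤ C * prodAt (headCounts Ls) as
  bound as = begin
    f as ²                                          ≤⟨ ²-mono-≤ (indicator-*-≤ (allEven? as) _) ⟩
    countEven (zipWith tailsWithHead as Ls) ²       ≤⟨ countEven-²-≤ c (zipWith tailsWithHead as Ls) (unique-tails as) ⟩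
    C * prodLength (zipWith tailsWithHead as Ls)    ≡⟨ cong (C *_) (prodLength-zipWith as Ls) ⟩
    C * prodAt (headCounts Ls) as                   ∎
  regroup : ∀ d x → x * x * (d * d) ≡ d * x * (d * x)
  regroup = solve-∀

length-filter : ∀ {A : Set} {P : A → Set} (P? : ∀ x → Dec (P x)) (L : List A) →
  length (filter P? L) ≡ sumList L (λ x → indicator (P? x))
length-filter P? []      = refl
length-filter P? (x ∷ L) with P? x
... | yes _ = cong suc (length-filter P? L)
... | no  _ = length-filter P? L

sumList-tuples : ∀ {A : Set} (X : List A) m (F : List A → ℕ) →
  sumList (tuples X m) F ≡ sumTuples (replicate m X) (F ∘ toList)
sumList-tuples X zero    F = +-identityʳ (F [])
sumList-tuples X (suc m) F = begin
  sumList (concatMap (λ x → map (x ∷_) (tuples X m)) X) F   ≡⟨ sumList-concatMap (λ x → map (x ∷_) (tuples X m)) X F ⟩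
  sumList X (λ x → sumList (map (x ∷_) (tuples X m)) F)     ≡⟨ sumList-cong X (λ x → sumList-map (x ∷_) (tuples X m) F) ⟩
  sumList X (λ x → sumList (tuples X m) (λ xs → F (x ∷ xs))) ≡⟨ sumList-cong X (λ x → sumList-tuples X m (λ xs → F (x ∷ xs))) ⟩
  sumTuples (replicate (suc m) X) (F ∘ toList)              ∎
  where open ≡-Reasoning

⊕-all-toList : ∀ {c s m} (xs : Vec (Key c s) m) i a → ⊕-all (toList xs) i a ≡ parity a (column i xs)
⊕-all-toList []       i a = refl
⊕-all-toList (x ∷ xs) i a = cong (does (lookup x i ≟ a) xor_) (⊕-all-toList xs i a)

indicator-isEmpty-⊕-all : ∀ {c s m} (xs : Vec (Key c s) m) →
  indicator (isEmpty? (⊕-all (toList xs))) ≡ indicator (columnsEven? xs)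
indicator-isEmpty-⊕-all xs = indicator-⇔ (isEmpty? _) (columnsEven? xs)
  (λ empty i a → trans (sym (⊕-all-toList xs i a)) (empty i a))
  (λ even i a → trans (⊕-all-toList xs i a) (even i a))

count-tuples≡countEven : ∀ {c s} (X : List (Key c s)) m →
  length (filter (λ xs → isEmpty? (⊕-all xs)) (tuples X m)) ≡ countEven (replicate m X)
count-tuples≡countEven X m = begin
  length (filter (λ xs → isEmpty? (⊕-all xs)) (tuples X m))                      ≡⟨ length-filter (λ xs → isEmpty? (⊕-all xs)) (tuples X m) ⟩
  sumList (tuples X m) (λ xs → indicator (isEmpty? (⊕-all xs)))                  ≡⟨ sumList-tuples X m _ ⟩
  sumTuples (replicate m X) (λ xs → indicator (isEmpty? (⊕-all (toList xs))))    ≡⟨ sumTuples-cong (replicate m X) indicator-isEmpty-⊕-all ⟩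
  countEven (replicate m X)                                                      ∎
  where open ≡-Reasoning

prodLength-replicate : ∀ {A : Set} (X : List A) m → prodLength (replicate m X) ≡ length X ^ m
prodLength-replicate X zero    = refl
prodLength-replicate X (suc m) = cong (length X *_) (prodLength-replicate X m)

predDoubleFact-double : ∀ t → predDoubleFact (2 * t) ≡ oddDoubleFact t
predDoubleFact-double zero    = refl
predDoubleFact-double (suc t) = trans (cong predDoubleFact (*-suc 2 t)) (cong (suc (2 * t) *_) (predDoubleFact-double t))

^-double : ∀ x t → x ^ (2 * t) ≡ (x ^ t) ²
^-double x t = trans (^-distribˡ-+-* x t (t + 0)) (cong (λ k → x ^ t * x ^ k) (+-identityʳ t))

lemma12 : (c s n t : ℕ) (X : List (Key c s)) → Unique X → length X ≡ n →
    length (filter (λ xs → isEmpty? (⊕-all xs)) (tuples X (2 * t)))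
    ≤ oddDoubleFact t ^ c * n ^ t
lemma12 c s n t X unique refl = ²-cancel-≤ (begin
  length (filter (λ xs → isEmpty? (⊕-all xs)) (tuples X (2 * t))) ²
    ≡⟨ cong _² (count-tuples≡countEven X (2 * t)) ⟩
  countEven (replicate (2 * t) X) ²
    ≤⟨ countEven-²-≤ c (replicate (2 * t) X) (λ i → subst Unique (sym (lookup-replicate i X)) unique) ⟩
  (predDoubleFact (2 * t) ^ c) ² * prodLength (replicate (2 * t) X)
    ≡⟨ cong₂ (λ d p → (d ^ c) ² * p) (predDoubleFact-double t) (trans (prodLength-replicate X (2 * t)) (^-double n t)) ⟩
  (oddDoubleFact t ^ c) ² * (n ^ t) ²
    ≡⟨ regroup (oddDoubleFact t ^ c) (n ^ t) ⟩
  (oddDoubleFact t ^ c * n ^ t) ² ∎)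
  where
  open ≤-Reasoning
  regroup : ∀ a b → a * a * (b * b) ≡ a * b * (a * b)
  regroup = solve-∀
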